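{- Let $(\Omega,S)$ be a regular thin Jordan scheme, fix $\omega_0\in\Omega$ and let $\diamond$ be as in the context. Then $(S,\diamond)$ is a Moufang loop.
   Context: $\Omega$ is a finite nonempty set, $\mathbb{F}$ a field with $\mathrm{char}\,\mathbb{F}\neq2$, $A\star B=\tfrac12(AB+BA)$. A regular thin Jordan scheme $(\Omega,S)$ here means: $S$ is a set of permutations of $\Omega$, each regarded as the relation $\{(\omega,s(\omega))\}$, such that these relations partition $\Omega\times\Omega$, $1_\Omega\in S$, $s^{ -1}\in S$ for every $s\in S$, and the $\mathbb{F}$-span of the permutation matrices of the elements of $S$ is closed under $\star$. For fixed $\omega_0\in\Omega$ and $a,b\in S$, $a\diamond b$ is the unique $c\in S$ with $c(\omega_0)=a(b(\omega_0))$. -}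

module Defs where

open import Level using (Level; _⊔_; suc)
open import Data.Nat using (ℕ; zero) renaming (suc to sucℕ)
open import Data.Fin using (Fin; _≟_)
open import Data.Fin.Permutation using (Permutation′; _⟨$⟩ʳ_)
open import Data.Product using (Σ; ∃; ∃!; _×_; proj₁)
open import Relation.Nullary using (¬_)
open import Relation.Nullary.Decidable using (⌊_⌋)
open import Data.Bool using (if_then_else_)
open import Relation.Binary.PropositionalEquality using (_≡_)
open import Algebra.Bundles using (CommutativeRing)

record Field (c ℓ : Level) : Set (suc (c ⊔ ℓ)) where
  field
    commutativeRing : CommutativeRing c ℓ
  open CommutativeRing commutativeRing public
  field
    1≉0     : ¬ (1# ≈ 0#)
    inverse : ∀ x → ¬ (x ≈ 0#) → Σ Carrier (λ y → (x * y) ≈ 1#)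

module FieldOps {c ℓ : Level} (F : Field c ℓ) where
  open Field F

  CharNot2 : Set ℓ
  CharNot2 = ¬ ((1# + 1#) ≈ 0#)

  Matrix : ℕ → Set c
  Matrix n = Fin n → Fin n → Carrier

  Σ[_] : ∀ {k} → (Fin k → Carrier) → Carrier
  Σ[_] {zero}   f = 0#
  Σ[_] {sucℕ k} f = f Fin.zero + Σ[ (λ i → f (Fin.suc i)) ]

  _·_ : ∀ {n} → Matrix n → Matrix n → Matrix n
  (A · B) i j = Σ[ (λ k → A i k * B k j) ]

  _⊕_ : ∀ {n} → Matrix n → Matrix n → Matrix n
  (A ⊕ B) i j = A i j + B i j

  _≈ᴹ_ : ∀ {n} → Matrix n → Matrix n → Set ℓ
  A ≈ᴹ B = ∀ i j → A i j ≈ B i j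

  jordan : CharNot2 → ∀ {n} → Matrix n → Matrix n → Matrix n
  jordan ch A B i j = proj₁ (inverse (1# + 1#) ch) * ((A · B) ⊕ (B · A)) i j

  permMatrix : ∀ {n} → Permutation′ n → Matrix n
  permMatrix s ω ω′ = if ⌊ (s ⟨$⟩ʳ ω) ≟ ω′ ⌋ then 1# else 0#

  lincomb : ∀ {n m} → (Fin m → Permutation′ n) → (Fin m → Carrier) → Matrix n
  lincomb σ a ω ω′ = Σ[ (λ i → a i * permMatrix (σ i) ω ω′) ]

  InSpan : ∀ {n m} → (Fin m → Permutation′ n) → Matrix n → Set (c ⊔ ℓ)
  InSpan {m = m} σ A = ∃ λ (a : Fin m → Carrier) → lincomb σ a ≈ᴹ A

  -- Regular thin Jordan scheme on Ω = Fin n over F.  S is given as a family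
  -- σ : Fin m → Permutation′ n (S = image of σ).
  record IsRegularThinJordanScheme (ch : CharNot2) (n m : ℕ)
         (σ : Fin m → Permutation′ n) : Set (c ⊔ ℓ) where
    field
      partition : ∀ (ω ω′ : Fin n) → ∃! _≡_ (λ i → σ i ⟨$⟩ʳ ω ≡ ω′)
      hasId     : ∃ λ i → ∀ ω → σ i ⟨$⟩ʳ ω ≡ ω
      hasInv    : ∀ i → ∃ λ j → ∀ ω → σ j ⟨$⟩ʳ (σ i ⟨$⟩ʳ ω) ≡ ω
      jordanClosed : ∀ A B → InSpan σ A → InSpan σ B → InSpan σ (jordan ch A B)

-- Write a ⊳ ω for the action of a ∈ S and P a for its permutation matrix. A matrix
-- Σₜ kₜ P t has entry kₜ at (ω, t ⊳ ω) for every ω. For P a ⋆ P b this says that the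
-- unordered pair {b ⊳ a ⊳ ω, a ⊳ b ⊳ ω} equals {c ⊳ ω, d ⊳ ω} for all ω, where c and d
-- agree with ba and ab at ω₀; for 2 P a ⋆ (P a ⋆ P b) − (P a ⋆ P a) ⋆ P b = P a P b P a
-- it says that aba lies in S. Read in (S, ⋄) these are the identity
-- {y(xz), x(yz)} = {(yx)z, (xy)z} and the left Bol identity. The first makes commuting
-- elements associate, which yields the right inverse property; then inversion is an
-- anti-automorphism, it turns left Bol into right Bol, and both Bol identities give Moufang.

module Submission where

open import Defs
open import Level using (Level)
open import Data.Nat using (ℕ; zero; suc)
open import Data.Fin using (Fin; _≟_)
import Data.Fin as Fin
open import Data.Fin.Properties using (suc-injective)
open import Data.Fin.Permutation using (Permutation′; _⟨$⟩ʳ_; _⟨$⟩ˡ_; inverseˡ; inverseʳ)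
open import Data.Bool using (Bool; true; false; if_then_else_; T)
open import Data.Unit using (tt)
open import Data.Empty using (⊥-elim)
open import Data.Product using (Σ; ∃; _,_; proj₁; proj₂; _×_)
import Data.Product as Product
open import Data.Sum using (_⊎_; inj₁; inj₂)
import Data.Sum as Sum
open import Function.Bundles using (mk⇔)
open import Relation.Nullary using (¬_)
open import Relation.Nullary.Decidable using (Dec; ⌊_⌋; does-⇔; isYes≗does; dec-true; toWitness; fromWitness)
open import Relation.Binary.Definitions using (DecidableEquality)
open import Relation.Binary.PropositionalEquality using (_≡_)
import Relation.Binary.PropositionalEquality as ≡
open import Algebra.Core using (Op₁; Op₂)
open import Algebra.Structures using (IsMoufangLoop)
import Algebra.Properties.Group as GroupProperties
import Algebra.Properties.CommutativeSemigroup as CommutativeSemigroupProperties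

SameUnorderedPair : ∀ {a} {A : Set a} → A → A → A → A → Set a
SameUnorderedPair x₁ x₂ y₁ y₂ = (x₁ ≡ y₁ × x₂ ≡ y₂) ⊎ (x₁ ≡ y₂ × x₂ ≡ y₁)

sameUnorderedPair : ∀ {a} {A : Set a} {x₁ x₂ y₁ y₂ : A} →
  y₁ ≡ x₁ ⊎ y₂ ≡ x₁ → y₁ ≡ x₂ ⊎ y₂ ≡ x₂ → (x₁ ≡ x₂ → y₁ ≡ x₁ × y₂ ≡ x₁) →
  SameUnorderedPair x₁ x₂ y₁ y₂
sameUnorderedPair (inj₁ ≡.refl) (inj₂ ≡.refl) _ = inj₁ (≡.refl , ≡.refl)
sameUnorderedPair (inj₂ ≡.refl) (inj₁ ≡.refl) _ = inj₂ (≡.refl , ≡.refl)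
sameUnorderedPair (inj₁ ≡.refl) (inj₁ ≡.refl) twice with ≡.refl ← proj₂ (twice ≡.refl) = inj₁ (≡.refl , ≡.refl)
sameUnorderedPair (inj₂ ≡.refl) (inj₂ ≡.refl) twice with ≡.refl ← proj₁ (twice ≡.refl) = inj₁ (≡.refl , ≡.refl)

module FieldProperties {c ℓ : Level} (F : Field c ℓ) (ch : FieldOps.CharNot2 F) where
  open Field F
  open import Relation.Binary.Reasoning.Setoid setoid
  open GroupProperties +-group using () renaming (∙-cancelˡ to +-cancelˡ; ∙-cancelʳ to +-cancelʳ)
  open CommutativeSemigroupProperties +-commutativeSemigroup using (interchange)

  ½ : Carrier
  ½ = proj₁ (inverse (1# + 1#) ch)

  x+x≈2x : ∀ x → x + x ≈ (1# + 1#) * x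
  x+x≈2x x = begin
    x + x           ≈⟨ +-cong (*-identityˡ x) (*-identityˡ x) ⟨
    1# * x + 1# * x ≈⟨ distribʳ x 1# 1# ⟨
    (1# + 1#) * x   ∎

  ½*[x+x] : ∀ x → ½ * (x + x) ≈ x
  ½*[x+x] x = begin
    ½ * (x + x)           ≈⟨ *-congˡ (x+x≈2x x) ⟩
    ½ * ((1# + 1#) * x)   ≈⟨ *-assoc ½ (1# + 1#) x ⟨
    (½ * (1# + 1#)) * x   ≈⟨ *-congʳ (trans (*-comm ½ _) (proj₂ (inverse (1# + 1#) ch))) ⟩
    1# * x                ≈⟨ *-identityˡ x ⟩
    x                     ∎

  ½*x+½*x : ∀ x → ½ * x + ½ * x ≈ x
  ½*x+½*x x = trans (sym (distribˡ ½ x x)) (½*[x+x] x)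

  ½*-injective : ∀ {x y} → ½ * x ≈ ½ * y → x ≈ y
  ½*-injective {x} {y} eq = begin
    x             ≈⟨ ½*x+½*x x ⟨
    ½ * x + ½ * x ≈⟨ +-cong eq eq ⟩
    ½ * y + ½ * y ≈⟨ ½*x+½*x y ⟩
    y             ∎

  ½-sum-of-sums : ∀ X Y Z → ½ * (X + Y) + ½ * (Y + Z) ≈ ½ * (X + Z) + Y
  ½-sum-of-sums X Y Z = begin
    ½ * (X + Y) + ½ * (Y + Z) ≈⟨ distribˡ ½ (X + Y) (Y + Z) ⟨
    ½ * ((X + Y) + (Y + Z))   ≈⟨ *-congˡ (trans (+-congˡ (+-comm Y Z)) (interchange X Y Z Y)) ⟩
    ½ * ((X + Z) + (Y + Y))   ≈⟨ distribˡ ½ (X + Z) (Y + Y) ⟩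
    ½ * (X + Z) + ½ * (Y + Y) ≈⟨ +-congˡ (½*[x+x] Y) ⟩
    ½ * (X + Z) + Y           ∎

  -- Entrywise, 2·(P ⋆ (P ⋆ Q)) − (P ⋆ P) ⋆ Q = PQP for permutation matrices P, Q.
  middle-determined : ∀ {X Y Z X′ Y′ Z′} →
    ½ * (½ * (X + Y) + ½ * (Y + Z)) ≈ ½ * (½ * (X′ + Y′) + ½ * (Y′ + Z′)) →
    ½ * (½ * (X + X) + ½ * (Z + Z)) ≈ ½ * (½ * (X′ + X′) + ½ * (Z′ + Z′)) →
    Y ≈ Y′
  middle-determined {X} {Y} {Z} {X′} {Y′} {Z′} d e = +-cancelˡ (½ * (X + Z)) Y Y′ (begin
    ½ * (X + Z) + Y           ≈⟨ ½-sum-of-sums X Y Z ⟨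
    ½ * (X + Y) + ½ * (Y + Z) ≈⟨ ½*-injective d ⟩
    ½ * (X′ + Y′) + ½ * (Y′ + Z′) ≈⟨ ½-sum-of-sums X′ Y′ Z′ ⟩
    ½ * (X′ + Z′) + Y′        ≈⟨ +-congʳ outer ⟨
    ½ * (X + Z) + Y′          ∎)
    where
    halves : ∀ X Z → ½ * (½ * (X + X) + ½ * (Z + Z)) ≈ ½ * (X + Z)
    halves X Z = *-congˡ (+-cong (½*[x+x] X) (½*[x+x] Z))
    outer : ½ * (X + Z) ≈ ½ * (X′ + Z′)
    outer = trans (sym (halves X Z)) (trans e (halves X′ Z′))

  𝟙 : Bool → Carrier
  𝟙 b = if b then 1# else 0#

  𝟙≈1⇒T : ∀ {p} → 𝟙 p ≈ 1# → T p
  𝟙≈1⇒T {true}  _  = tt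
  𝟙≈1⇒T {false} eq = ⊥-elim (1≉0 (sym eq))

  2≉1 : ¬ (1# + 1# ≈ 1#)
  2≉1 eq = 1≉0 (+-cancelˡ 1# 1# 0# (trans eq (sym (+-identityʳ 1#))))

  occurs : ∀ {p q r s} → T p ⊎ T q → 𝟙 p + 𝟙 q ≈ 𝟙 r + 𝟙 s → T r ⊎ T s
  occurs {r = true} _ _ = inj₁ tt
  occurs {r = false} {true} _ _ = inj₂ tt
  occurs {true}  {true}  {false} {false} _ eq = ⊥-elim (ch (trans eq (+-identityʳ 0#)))
  occurs {true}  {false} {false} {false} _ eq = ⊥-elim (1≉0 (+-cancelʳ 0# 1# 0# eq))
  occurs {false} {true}  {false} {false} _ eq = ⊥-elim (1≉0 (+-cancelˡ 0# 1# 0# eq))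
  occurs {false} {false} {false} {false} (inj₁ ()) _
  occurs {false} {false} {false} {false} (inj₂ ()) _

  occurs-twice : ∀ {p q r s} → T p → T q → 𝟙 p + 𝟙 q ≈ 𝟙 r + 𝟙 s → T r × T s
  occurs-twice {true} {true} {true}  {true}  _ _ _  = tt , tt
  occurs-twice {true} {true} {true}  {false} _ _ eq = ⊥-elim (2≉1 (trans eq (+-identityʳ 1#)))
  occurs-twice {true} {true} {false} {true}  _ _ eq = ⊥-elim (2≉1 (trans eq (+-identityˡ 1#)))
  occurs-twice {true} {true} {false} {false} _ _ eq = ⊥-elim (ch (trans eq (+-identityʳ 0#)))

  indicatorSums⇒sameUnorderedPair : ∀ {a} {A : Set a} (_≟_ : DecidableEquality A) {x₁ x₂ y₁ y₂ : A} →
    (∀ w → 𝟙 ⌊ x₁ ≟ w ⌋ + 𝟙 ⌊ x₂ ≟ w ⌋ ≈ 𝟙 ⌊ y₁ ≟ w ⌋ + 𝟙 ⌊ y₂ ≟ w ⌋) →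
    SameUnorderedPair x₁ x₂ y₁ y₂
  indicatorSums⇒sameUnorderedPair _≟_ {x₁} {x₂} {y₁} {y₂} eq =
    sameUnorderedPair (contains (inj₁ ≡.refl)) (contains (inj₂ ≡.refl)) twice
    where
    contains : ∀ {w} → x₁ ≡ w ⊎ x₂ ≡ w → y₁ ≡ w ⊎ y₂ ≡ w
    contains {w} x∈ = Sum.map toWitness toWitness
      (occurs (Sum.map fromWitness fromWitness x∈) (eq w))
    twice : x₁ ≡ x₂ → y₁ ≡ x₁ × y₂ ≡ x₁
    twice x₁≡x₂ = Product.map toWitness toWitness
      (occurs-twice (fromWitness ≡.refl) (fromWitness (≡.sym x₁≡x₂)) (eq x₁))

⌊⌋-cong : ∀ {a b} {A : Set a} {B : Set b} (a? : Dec A) (b? : Dec B) → (A → B) → (B → A) → ⌊ a? ⌋ ≡ ⌊ b? ⌋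
⌊⌋-cong a? b? to from = ≡.trans (isYes≗does a?) (≡.trans (does-⇔ (mk⇔ to from) a? b?) (≡.sym (isYes≗does b?)))

module PermutationMatrixProperties {c ℓ : Level} (F : Field c ℓ) (ch : FieldOps.CharNot2 F) where
  open Field F
  open FieldOps F
  open FieldProperties F ch
  open import Relation.Binary.Reasoning.Setoid setoid

  δ : ∀ {k} → Fin k → Fin k → Carrier
  δ x y = 𝟙 ⌊ x ≟ y ⌋

  Σ-cong : ∀ {k} {f g : Fin k → Carrier} → (∀ i → f i ≈ g i) → Σ[ f ] ≈ Σ[ g ]
  Σ-cong {zero}  eq = refl
  Σ-cong {suc k} eq = +-cong (eq Fin.zero) (Σ-cong (λ i → eq (Fin.suc i)))

  Σ-zero : ∀ {k} {f : Fin k → Carrier} → (∀ i → f i ≈ 0#) → Σ[ f ] ≈ 0#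
  Σ-zero {zero}  eq = refl
  Σ-zero {suc k} eq = trans (+-cong (eq Fin.zero) (Σ-zero (λ i → eq (Fin.suc i)))) (+-identityʳ 0#)

  δ-suc : ∀ {k} (x y : Fin k) → δ (Fin.suc x) (Fin.suc y) ≡ δ x y
  δ-suc x y = ≡.cong 𝟙 (⌊⌋-cong (Fin.suc x ≟ Fin.suc y) (x ≟ y) suc-injective (≡.cong Fin.suc))

  Σ-δˡ : ∀ {k} (x : Fin k) (f : Fin k → Carrier) → Σ[ (λ y → δ x y * f y) ] ≈ f x
  Σ-δˡ {suc k} Fin.zero f = begin
    1# * f Fin.zero + Σ[ (λ i → 0# * f (Fin.suc i)) ] ≈⟨ +-cong (*-identityˡ _) (Σ-zero {k} (λ i → zeroˡ _)) ⟩
    f Fin.zero + 0#                                   ≈⟨ +-identityʳ _ ⟩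
    f Fin.zero                                        ∎
  Σ-δˡ {suc k} (Fin.suc x) f = begin
    0# * f Fin.zero + Σ[ (λ i → δ (Fin.suc x) (Fin.suc i) * f (Fin.suc i)) ]
      ≈⟨ +-cong (zeroˡ _) (Σ-cong {k} (λ i → *-congʳ (reflexive (δ-suc x i)))) ⟩
    0# + Σ[ (λ i → δ x i * f (Fin.suc i)) ] ≈⟨ +-identityˡ _ ⟩
    Σ[ (λ i → δ x i * f (Fin.suc i)) ]       ≈⟨ Σ-δˡ x (λ i → f (Fin.suc i)) ⟩
    f (Fin.suc x)                            ∎

  δ-refl : ∀ {k} (x : Fin k) → δ x x ≡ 1#
  δ-refl x = ≡.cong 𝟙 (≡.trans (isYes≗does (x ≟ x)) (dec-true (x ≟ x) ≡.refl))

  δ-sym : ∀ {k} (x y : Fin k) → δ x y ≡ δ y x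
  δ-sym x y = ≡.cong 𝟙 (⌊⌋-cong (x ≟ y) (y ≟ x) ≡.sym ≡.sym)

  Σ-δʳ : ∀ {k} (x : Fin k) (f : Fin k → Carrier) → Σ[ (λ y → f y * δ y x) ] ≈ f x
  Σ-δʳ {k} x f = trans (Σ-cong {k} (λ i → trans (*-comm _ _) (*-congʳ (reflexive (δ-sym i x))))) (Σ-δˡ x f)

  δ-⟨$⟩ˡ : ∀ {n} (s : Permutation′ n) x y → δ x (s ⟨$⟩ˡ y) ≡ δ (s ⟨$⟩ʳ x) y
  δ-⟨$⟩ˡ s x y = ≡.cong 𝟙 (⌊⌋-cong (x ≟ s ⟨$⟩ˡ y) (s ⟨$⟩ʳ x ≟ y)
    (λ eq → ≡.trans (≡.cong (s ⟨$⟩ʳ_) eq) (inverseʳ s))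
    (λ eq → ≡.trans (≡.sym (inverseˡ s)) (≡.cong (s ⟨$⟩ˡ_) eq)))

  permMatrix-·ˡ : ∀ {n} (s : Permutation′ n) (M : Matrix n) i j → (permMatrix s · M) i j ≈ M (s ⟨$⟩ʳ i) j
  permMatrix-·ˡ s M i j = Σ-δˡ (s ⟨$⟩ʳ i) (λ k → M k j)

  permMatrix-·ʳ : ∀ {n} (s : Permutation′ n) (M : Matrix n) i j → (M · permMatrix s) i j ≈ M i (s ⟨$⟩ˡ j)
  permMatrix-·ʳ {n} s M i j = begin
    Σ[ (λ k → M i k * δ (s ⟨$⟩ʳ k) j) ]  ≈⟨ Σ-cong {n} (λ k → *-congˡ (reflexive (≡.sym (δ-⟨$⟩ˡ s k j)))) ⟩
    Σ[ (λ k → M i k * δ k (s ⟨$⟩ˡ j)) ]  ≈⟨ Σ-δʳ (s ⟨$⟩ˡ j) (M i) ⟩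
    M i (s ⟨$⟩ˡ j)                        ∎

  jordan-permMatrixˡ : ∀ {n} (s : Permutation′ n) (M : Matrix n) i j →
    jordan ch (permMatrix s) M i j ≈ ½ * (M (s ⟨$⟩ʳ i) j + M i (s ⟨$⟩ˡ j))
  jordan-permMatrixˡ s M i j = *-congˡ (+-cong (permMatrix-·ˡ s M i j) (permMatrix-·ʳ s M i j))

  jordan-permMatrixʳ : ∀ {n} (s : Permutation′ n) (M : Matrix n) i j →
    jordan ch M (permMatrix s) i j ≈ ½ * (M i (s ⟨$⟩ˡ j) + M (s ⟨$⟩ʳ i) j)
  jordan-permMatrixʳ s M i j = *-congˡ (+-cong (permMatrix-·ʳ s M i j) (permMatrix-·ˡ s M i j))

module RegularThinJordanSchemeProperties {c ℓ : Level} (F : Field c ℓ) (ch : FieldOps.CharNot2 F)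
  {n m : ℕ} {σ : Fin m → Permutation′ n}
  (S : FieldOps.IsRegularThinJordanScheme F ch n m σ) where
  open Field F
  open FieldOps F
  open FieldProperties F ch
  open PermutationMatrixProperties F ch
  open IsRegularThinJordanScheme S
  open import Relation.Binary.Reasoning.Setoid setoid

  infixr 6 _⊳_
  _⊳_ : Fin m → Fin n → Fin n
  a ⊳ ω = σ a ⟨$⟩ʳ ω

  P : Fin m → Matrix n
  P a = permMatrix (σ a)

  ⊳-injectiveˡ : ∀ {a b ω} → a ⊳ ω ≡ b ⊳ ω → a ≡ b
  ⊳-injectiveˡ {a} {b} {ω} eq with _ , _ , unique ← partition ω (b ⊳ ω) = ≡.trans (≡.sym (unique eq)) (unique ≡.refl)

  δ-⊳ : ∀ a b ω → δ (a ⊳ ω) (b ⊳ ω) ≡ δ a b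
  δ-⊳ a b ω = ≡.cong 𝟙 (⌊⌋-cong (a ⊳ ω ≟ b ⊳ ω) (a ≟ b) ⊳-injectiveˡ (≡.cong (_⊳ ω)))

  lincomb-⊳ : ∀ (k : Fin m → Carrier) t ω → lincomb σ k ω (t ⊳ ω) ≈ k t
  lincomb-⊳ k t ω = trans (Σ-cong {m} (λ i → *-congˡ (reflexive (δ-⊳ i t ω)))) (Σ-δʳ t k)

  InSpan⇒constant-on-relations : ∀ {M} {f : Matrix n} → InSpan σ M → (∀ ω w → M ω w ≈ f ω w) →
    ∀ t ω ω′ → f ω (t ⊳ ω) ≈ f ω′ (t ⊳ ω′)
  InSpan⇒constant-on-relations {M} {f} (k , k≈M) M≈f t ω ω′ = begin
    f ω (t ⊳ ω)                ≈⟨ trans (k≈M ω (t ⊳ ω)) (M≈f ω (t ⊳ ω)) ⟨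
    lincomb σ k ω (t ⊳ ω)      ≈⟨ lincomb-⊳ k t ω ⟩
    k t                        ≈⟨ lincomb-⊳ k t ω′ ⟨
    lincomb σ k ω′ (t ⊳ ω′)    ≈⟨ trans (k≈M ω′ (t ⊳ ω′)) (M≈f ω′ (t ⊳ ω′)) ⟩
    f ω′ (t ⊳ ω′)              ∎

  P∈span : ∀ a → InSpan σ (P a)
  P∈span a = δ a , λ ω ω′ → Σ-δˡ a (λ i → P i ω ω′)

  P⋆P∈span : ∀ a b → InSpan σ (jordan ch (P a) (P b))
  P⋆P∈span a b = jordanClosed _ _ (P∈span a) (P∈span b)

  P⋆P-entry : ∀ a b ω w → jordan ch (P a) (P b) ω w ≈ ½ * (δ (b ⊳ a ⊳ ω) w + δ (a ⊳ b ⊳ ω) w)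
  P⋆P-entry a b ω w = trans (jordan-permMatrixˡ (σ a) (P b) ω w)
    (*-congˡ (+-congˡ (reflexive (δ-⟨$⟩ˡ (σ a) (b ⊳ ω) w))))

  P⋆[P⋆P]-entry : ∀ a b ω w → jordan ch (P a) (jordan ch (P a) (P b)) ω w ≈
    ½ * (½ * (δ (b ⊳ a ⊳ a ⊳ ω) w + δ (a ⊳ b ⊳ a ⊳ ω) w)
       + ½ * (δ (a ⊳ b ⊳ a ⊳ ω) w + δ (a ⊳ a ⊳ b ⊳ ω) w))
  P⋆[P⋆P]-entry a b ω w = trans (jordan-permMatrixˡ (σ a) _ ω w) (*-congˡ (+-cong
    (P⋆P-entry a b (a ⊳ ω) w)
    (trans (P⋆P-entry a b ω (σ a ⟨$⟩ˡ w))
      (*-congˡ (+-cong (reflexive (δ-⟨$⟩ˡ (σ a) _ w)) (reflexive (δ-⟨$⟩ˡ (σ a) _ w)))))))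

  [P⋆P]⋆P-entry : ∀ a b ω w → jordan ch (jordan ch (P a) (P a)) (P b) ω w ≈
    ½ * (½ * (δ (b ⊳ a ⊳ a ⊳ ω) w + δ (b ⊳ a ⊳ a ⊳ ω) w)
       + ½ * (δ (a ⊳ a ⊳ b ⊳ ω) w + δ (a ⊳ a ⊳ b ⊳ ω) w))
  [P⋆P]⋆P-entry a b ω w = trans (jordan-permMatrixʳ (σ b) _ ω w) (*-congˡ (+-cong
    (trans (P⋆P-entry a a ω (σ b ⟨$⟩ˡ w))
      (*-congˡ (+-cong (reflexive (δ-⟨$⟩ˡ (σ b) _ w)) (reflexive (δ-⟨$⟩ˡ (σ b) _ w)))))
    (P⋆P-entry a a (b ⊳ ω) w)))

  composites-sameUnorderedPair : ∀ {a b c d ω′} → c ⊳ ω′ ≡ b ⊳ a ⊳ ω′ → d ⊳ ω′ ≡ a ⊳ b ⊳ ω′ →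
    ∀ ω → SameUnorderedPair (b ⊳ a ⊳ ω) (a ⊳ b ⊳ ω) (c ⊳ ω) (d ⊳ ω)
  composites-sameUnorderedPair {a} {b} {c} {d} {ω′} c≡ba d≡ab ω = indicatorSums⇒sameUnorderedPair _≟_ sums
    where
    along : ∀ t → δ (b ⊳ a ⊳ ω) (t ⊳ ω) + δ (a ⊳ b ⊳ ω) (t ⊳ ω) ≈ δ (c ⊳ ω) (t ⊳ ω) + δ (d ⊳ ω) (t ⊳ ω)
    along t = begin
      δ (b ⊳ a ⊳ ω) (t ⊳ ω) + δ (a ⊳ b ⊳ ω) (t ⊳ ω)
        ≈⟨ ½*-injective (InSpan⇒constant-on-relations (P⋆P∈span a b) (P⋆P-entry a b) t ω ω′) ⟩
      δ (b ⊳ a ⊳ ω′) (t ⊳ ω′) + δ (a ⊳ b ⊳ ω′) (t ⊳ ω′)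
        ≡⟨ ≡.cong₂ (λ x y → δ x (t ⊳ ω′) + δ y (t ⊳ ω′)) (≡.sym c≡ba) (≡.sym d≡ab) ⟩
      δ (c ⊳ ω′) (t ⊳ ω′) + δ (d ⊳ ω′) (t ⊳ ω′)
        ≡⟨ ≡.cong₂ _+_ (≡.trans (δ-⊳ c t ω′) (≡.sym (δ-⊳ c t ω))) (≡.trans (δ-⊳ d t ω′) (≡.sym (δ-⊳ d t ω))) ⟩
      δ (c ⊳ ω) (t ⊳ ω) + δ (d ⊳ ω) (t ⊳ ω) ∎
    sums : ∀ w → δ (b ⊳ a ⊳ ω) w + δ (a ⊳ b ⊳ ω) w ≈ δ (c ⊳ ω) w + δ (d ⊳ ω) w
    sums w with t , ≡.refl , _ ← partition ω w = along t

  sandwich-closed : ∀ {a b t ω′} → t ⊳ ω′ ≡ a ⊳ b ⊳ a ⊳ ω′ → ∀ ω → a ⊳ b ⊳ a ⊳ ω ≡ t ⊳ ω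
  sandwich-closed {a} {b} {t} {ω′} t≡aba ω = toWitness (𝟙≈1⇒T (begin
    δ (a ⊳ b ⊳ a ⊳ ω) (t ⊳ ω)   ≈⟨ middle-determined
                                    (InSpan⇒constant-on-relations P⋆[P⋆P]∈span (P⋆[P⋆P]-entry a b) t ω ω′)
                                    (InSpan⇒constant-on-relations [P⋆P]⋆P∈span ([P⋆P]⋆P-entry a b) t ω ω′) ⟩
    δ (a ⊳ b ⊳ a ⊳ ω′) (t ⊳ ω′) ≡⟨ ≡.cong (λ x → δ x (t ⊳ ω′)) (≡.sym t≡aba) ⟩
    δ (t ⊳ ω′) (t ⊳ ω′)         ≡⟨ δ-refl (t ⊳ ω′) ⟩
    1#                          ∎))
    where
    P⋆[P⋆P]∈span : InSpan σ (jordan ch (P a) (jordan ch (P a) (P b)))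
    P⋆[P⋆P]∈span = jordanClosed _ _ (P∈span a) (P⋆P∈span a b)
    [P⋆P]⋆P∈span : InSpan σ (jordan ch (jordan ch (P a) (P a)) (P b))
    [P⋆P]⋆P∈span = jordanClosed _ _ (P⋆P∈span a a) (P∈span b)

record JordanBolLoop {a} (Q : Set a) : Set a where
  infix  7 _∙_
  infix  8 _⁻¹
  field
    _∙_ : Op₂ Q
    ε   : Q
    _⁻¹ : Op₁ Q
    identityˡ       : ∀ x → ε ∙ x ≡ x
    identityʳ       : ∀ x → x ∙ ε ≡ x
    inverse-cancelˡ : ∀ x y → x ⁻¹ ∙ (x ∙ y) ≡ y
    inverse-cancelʳ : ∀ x y → x ∙ (x ⁻¹ ∙ y) ≡ y
    leftBol         : ∀ x y z → x ∙ (y ∙ (x ∙ z)) ≡ (x ∙ (y ∙ x)) ∙ z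
    jordanPair      : ∀ x y z → SameUnorderedPair (y ∙ (x ∙ z)) (x ∙ (y ∙ z)) ((y ∙ x) ∙ z) ((x ∙ y) ∙ z)

module JordanBolLoopProperties {a} {Q : Set a} (L : JordanBolLoop Q) where
  open JordanBolLoop L
  open ≡ using (sym; trans; cong; cong₂; isEquivalence)
  open ≡.≡-Reasoning

  x∙x⁻¹≡ε : ∀ x → x ∙ x ⁻¹ ≡ ε
  x∙x⁻¹≡ε x = trans (cong (x ∙_) (sym (identityʳ (x ⁻¹)))) (inverse-cancelʳ x ε)

  x⁻¹∙x≡ε : ∀ x → x ⁻¹ ∙ x ≡ ε
  x⁻¹∙x≡ε x = trans (cong (x ⁻¹ ∙_) (sym (identityʳ x))) (inverse-cancelˡ x ε)

  ⁻¹-involutive : ∀ x → (x ⁻¹) ⁻¹ ≡ x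
  ⁻¹-involutive x = begin
    (x ⁻¹) ⁻¹                 ≡⟨ identityʳ _ ⟨
    (x ⁻¹) ⁻¹ ∙ ε             ≡⟨ cong ((x ⁻¹) ⁻¹ ∙_) (x⁻¹∙x≡ε x) ⟨
    (x ⁻¹) ⁻¹ ∙ (x ⁻¹ ∙ x)    ≡⟨ inverse-cancelˡ (x ⁻¹) x ⟩
    x                         ∎

  ⁻¹-injective : ∀ {x y} → x ⁻¹ ≡ y ⁻¹ → x ≡ y
  ⁻¹-injective {x} {y} eq = trans (sym (⁻¹-involutive x)) (trans (cong _⁻¹ eq) (⁻¹-involutive y))

  commute⇒associate : ∀ {x y} → x ∙ y ≡ y ∙ x → ∀ z → x ∙ (y ∙ z) ≡ (x ∙ y) ∙ z
  commute⇒associate {x} {y} xy≡yx z with jordanPair y x z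
  ... | inj₁ (eq , _) = eq
  ... | inj₂ (eq , _) = trans eq (cong (_∙ z) (sym xy≡yx))

  y∙[x∙x⁻¹]≡y : ∀ x y → y ∙ (x ∙ x ⁻¹) ≡ y
  y∙[x∙x⁻¹]≡y x y = trans (cong (y ∙_) (x∙x⁻¹≡ε x)) (identityʳ y)

  rightInverse : ∀ x y → (y ∙ x) ∙ x ⁻¹ ≡ y
  rightInverse x y with jordanPair x y (x ⁻¹)
  ... | inj₁ (eq , _) = trans (sym eq) (y∙[x∙x⁻¹]≡y x y)
  ... | inj₂ (eq , _) = trans (sym (commute⇒associate (sym xy≡yx) (x ⁻¹))) (y∙[x∙x⁻¹]≡y x y)
    where
    -- Here (x y) x⁻¹ = y = x⁻¹ (x y), so x y commutes with x⁻¹.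
    xy∙x⁻¹≡y : (x ∙ y) ∙ x ⁻¹ ≡ y
    xy∙x⁻¹≡y = trans (sym eq) (y∙[x∙x⁻¹]≡y x y)
    xy≡yx : x ∙ y ≡ y ∙ x
    xy≡yx = begin
      x ∙ y                        ≡⟨ identityʳ _ ⟨
      (x ∙ y) ∙ ε                  ≡⟨ cong ((x ∙ y) ∙_) (x⁻¹∙x≡ε x) ⟨
      (x ∙ y) ∙ (x ⁻¹ ∙ x)         ≡⟨ commute⇒associate (trans xy∙x⁻¹≡y (sym (inverse-cancelˡ x y))) x ⟩
      ((x ∙ y) ∙ x ⁻¹) ∙ x         ≡⟨ cong (_∙ x) xy∙x⁻¹≡y ⟩
      y ∙ x                        ∎

  rightInverse′ : ∀ x y → (y ∙ x ⁻¹) ∙ x ≡ y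
  rightInverse′ x y = trans (cong ((y ∙ x ⁻¹) ∙_) (sym (⁻¹-involutive x))) (rightInverse (x ⁻¹) y)

  ⁻¹-anti-homo : ∀ x y → (x ∙ y) ⁻¹ ≡ y ⁻¹ ∙ x ⁻¹
  ⁻¹-anti-homo x y = begin
    (x ∙ y) ⁻¹                                   ≡⟨ rightInverse x _ ⟨
    ((x ∙ y) ⁻¹ ∙ x) ∙ x ⁻¹                      ≡⟨ cong (λ u → ((x ∙ y) ⁻¹ ∙ u) ∙ x ⁻¹) (rightInverse y x) ⟨
    ((x ∙ y) ⁻¹ ∙ ((x ∙ y) ∙ y ⁻¹)) ∙ x ⁻¹       ≡⟨ cong (_∙ x ⁻¹) (inverse-cancelˡ (x ∙ y) (y ⁻¹)) ⟩
    y ⁻¹ ∙ x ⁻¹                                  ∎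

  rightBol : ∀ x y z → ((z ∙ x) ∙ y) ∙ x ≡ z ∙ ((x ∙ y) ∙ x)
  rightBol x y z = ⁻¹-injective (begin
    (((z ∙ x) ∙ y) ∙ x) ⁻¹              ≡⟨ ⁻¹-anti-homo _ _ ⟩
    x ⁻¹ ∙ ((z ∙ x) ∙ y) ⁻¹             ≡⟨ cong (x ⁻¹ ∙_) (⁻¹-anti-homo _ _) ⟩
    x ⁻¹ ∙ (y ⁻¹ ∙ (z ∙ x) ⁻¹)          ≡⟨ cong (λ u → x ⁻¹ ∙ (y ⁻¹ ∙ u)) (⁻¹-anti-homo _ _) ⟩
    x ⁻¹ ∙ (y ⁻¹ ∙ (x ⁻¹ ∙ z ⁻¹))       ≡⟨ leftBol _ _ _ ⟩
    (x ⁻¹ ∙ (y ⁻¹ ∙ x ⁻¹)) ∙ z ⁻¹       ≡⟨ cong (λ u → (x ⁻¹ ∙ u) ∙ z ⁻¹) (⁻¹-anti-homo x y) ⟨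
    (x ⁻¹ ∙ (x ∙ y) ⁻¹) ∙ z ⁻¹          ≡⟨ cong (_∙ z ⁻¹) (⁻¹-anti-homo _ _) ⟨
    ((x ∙ y) ∙ x) ⁻¹ ∙ z ⁻¹             ≡⟨ ⁻¹-anti-homo _ _ ⟨
    (z ∙ ((x ∙ y) ∙ x)) ⁻¹              ∎)

  flexible : ∀ x y → x ∙ (y ∙ x) ≡ (x ∙ y) ∙ x
  flexible x y = begin
    x ∙ (y ∙ x)                         ≡⟨ rightInverse′ x _ ⟨
    ((x ∙ (y ∙ x)) ∙ x ⁻¹) ∙ x          ≡⟨ cong (_∙ x) (leftBol x y (x ⁻¹)) ⟨
    (x ∙ (y ∙ (x ∙ x ⁻¹))) ∙ x          ≡⟨ cong (λ u → (x ∙ u) ∙ x) (y∙[x∙x⁻¹]≡y x y) ⟩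
    (x ∙ y) ∙ x                         ∎

  identical : ∀ x y z → (z ∙ x) ∙ (y ∙ z) ≡ z ∙ ((x ∙ y) ∙ z)
  identical x y z = begin
    (z ∙ x) ∙ (y ∙ z)                   ≡⟨ cong (λ u → (z ∙ u) ∙ (y ∙ z)) (rightInverse′ z x) ⟨
    (z ∙ ((x ∙ z ⁻¹) ∙ z)) ∙ (y ∙ z)    ≡⟨ leftBol z (x ∙ z ⁻¹) (y ∙ z) ⟨
    z ∙ ((x ∙ z ⁻¹) ∙ (z ∙ (y ∙ z)))    ≡⟨ cong (λ u → z ∙ ((x ∙ z ⁻¹) ∙ u)) (flexible z y) ⟩
    z ∙ ((x ∙ z ⁻¹) ∙ ((z ∙ y) ∙ z))    ≡⟨ cong (z ∙_) (rightBol z y (x ∙ z ⁻¹)) ⟨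
    z ∙ ((((x ∙ z ⁻¹) ∙ z) ∙ y) ∙ z)    ≡⟨ cong (λ u → z ∙ ((u ∙ y) ∙ z)) (rightInverse′ z x) ⟩
    z ∙ ((x ∙ y) ∙ z)                   ∎

  _\\_ : Op₂ Q
  x \\ y = x ⁻¹ ∙ y

  _//_ : Op₂ Q
  y // x = y ∙ x ⁻¹

  isMoufangLoop : IsMoufangLoop _≡_ _∙_ _\\_ _//_ ε
  isMoufangLoop = record
    { isLeftBolLoop = record
      { isLoop = record
        { isQuasigroup = record
          { isMagma      = record { isEquivalence = isEquivalence ; ∙-cong = cong₂ _∙_ }
          ; \\-cong      = cong₂ _\\_
          ; //-cong      = cong₂ _//_
          ; leftDivides  = inverse-cancelʳ , inverse-cancelˡ
          ; rightDivides = rightInverse′ , rightInverse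
          }
        ; identity = identityˡ , identityʳ
        }
      ; leftBol = leftBol
      }
    ; rightBol  = rightBol
    ; identical = identical
    }

module SchemeLoop {c ℓ : Level} (F : Field c ℓ) (ch : FieldOps.CharNot2 F)
  {n m : ℕ} {σ : Fin m → Permutation′ n}
  (S : FieldOps.IsRegularThinJordanScheme F ch n m σ)
  (ω₀ : Fin n) (_⋄_ : Op₂ (Fin m))
  (⋄-at-ω₀ : ∀ a b → σ (a ⋄ b) ⟨$⟩ʳ ω₀ ≡ σ a ⟨$⟩ʳ (σ b ⟨$⟩ʳ ω₀)) where
  open FieldOps.IsRegularThinJordanScheme S
  open RegularThinJordanSchemeProperties F ch S
  open ≡ using (sym; trans; cong)
  open ≡.≡-Reasoning

  ε : Fin m
  ε = proj₁ hasId

  _⁻¹ : Fin m → Fin m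
  a ⁻¹ = proj₁ (hasInv a)

  ⊳-inverseʳ : ∀ a ω → a ⊳ a ⁻¹ ⊳ ω ≡ ω
  ⊳-inverseʳ a ω = begin
    a ⊳ a ⁻¹ ⊳ ω                       ≡⟨ cong (λ u → a ⊳ a ⁻¹ ⊳ u) (inverseʳ (σ a)) ⟨
    a ⊳ a ⁻¹ ⊳ a ⊳ (σ a ⟨$⟩ˡ ω)        ≡⟨ cong (a ⊳_) (proj₂ (hasInv a) _) ⟩
    a ⊳ (σ a ⟨$⟩ˡ ω)                   ≡⟨ inverseʳ (σ a) ⟩
    ω                                  ∎

  ⋄-at-ω₀² : ∀ a b z → a ⊳ b ⊳ z ⊳ ω₀ ≡ (a ⋄ (b ⋄ z)) ⊳ ω₀
  ⋄-at-ω₀² a b z = sym (trans (⋄-at-ω₀ a (b ⋄ z)) (cong (a ⊳_) (⋄-at-ω₀ b z)))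

  action⇒⋄ : ∀ {a b c z} → a ⊳ b ⊳ z ⊳ ω₀ ≡ c ⊳ z ⊳ ω₀ → a ⋄ (b ⋄ z) ≡ c ⋄ z
  action⇒⋄ {a} {b} {c} {z} eq = ⊳-injectiveˡ (begin
    (a ⋄ (b ⋄ z)) ⊳ ω₀   ≡⟨ ⋄-at-ω₀² a b z ⟨
    a ⊳ b ⊳ z ⊳ ω₀       ≡⟨ eq ⟩
    c ⊳ z ⊳ ω₀           ≡⟨ ⋄-at-ω₀ c z ⟨
    (c ⋄ z) ⊳ ω₀         ∎)

  action⇒⋄-cancel : ∀ {a b z} → a ⊳ b ⊳ z ⊳ ω₀ ≡ z ⊳ ω₀ → a ⋄ (b ⋄ z) ≡ z
  action⇒⋄-cancel {a} {b} {z} eq = ⊳-injectiveˡ (trans (sym (⋄-at-ω₀² a b z)) eq)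

  ⋄-leftBol : ∀ x y z → x ⋄ (y ⋄ (x ⋄ z)) ≡ (x ⋄ (y ⋄ x)) ⋄ z
  ⋄-leftBol x y z = ⊳-injectiveˡ (begin
    (x ⋄ (y ⋄ (x ⋄ z))) ⊳ ω₀   ≡⟨ ⋄-at-ω₀² x y (x ⋄ z) ⟨
    x ⊳ y ⊳ (x ⋄ z) ⊳ ω₀       ≡⟨ cong (λ u → x ⊳ y ⊳ u) (⋄-at-ω₀ x z) ⟩
    x ⊳ y ⊳ x ⊳ z ⊳ ω₀         ≡⟨ sandwich-closed (sym (⋄-at-ω₀² x y x)) (z ⊳ ω₀) ⟩
    (x ⋄ (y ⋄ x)) ⊳ z ⊳ ω₀     ≡⟨ ⋄-at-ω₀ _ z ⟨
    ((x ⋄ (y ⋄ x)) ⋄ z) ⊳ ω₀   ∎)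

  jordanBolLoop : JordanBolLoop (Fin m)
  jordanBolLoop = record
    { _∙_             = _⋄_
    ; ε               = ε
    ; _⁻¹             = _⁻¹
    ; identityˡ       = λ a → ⊳-injectiveˡ (trans (⋄-at-ω₀ ε a) (proj₂ hasId _))
    ; identityʳ       = λ a → ⊳-injectiveˡ (trans (⋄-at-ω₀ a ε) (cong (a ⊳_) (proj₂ hasId ω₀)))
    ; inverse-cancelˡ = λ a b → action⇒⋄-cancel (proj₂ (hasInv a) _)
    ; inverse-cancelʳ = λ a b → action⇒⋄-cancel (⊳-inverseʳ a _)
    ; leftBol         = ⋄-leftBol
    ; jordanPair      = λ x y z → Sum.map (Product.map action⇒⋄ action⇒⋄) (Product.map action⇒⋄ action⇒⋄)
        (composites-sameUnorderedPair (⋄-at-ω₀ y x) (⋄-at-ω₀ x y) (z ⊳ ω₀))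
    }

proposition3p13 : {c ℓ : Level} (F : Field c ℓ) (ch : FieldOps.CharNot2 F)
    (n m : ℕ) (σ : Fin m → Permutation′ (suc n))
    → FieldOps.IsRegularThinJordanScheme F ch (suc n) m σ
    → (ω₀ : Fin (suc n)) (_⋄_ : Op₂ (Fin m))
    → (∀ a b → σ (a ⋄ b) ⟨$⟩ʳ ω₀ ≡ σ a ⟨$⟩ʳ (σ b ⟨$⟩ʳ ω₀))
    → Σ (Op₂ (Fin m)) λ _\\_ → Σ (Op₂ (Fin m)) λ _//_ → ∃ λ e →
    IsMoufangLoop {A = Fin m} _≡_ _⋄_ _\\_ _//_ e
proposition3p13 F ch n m σ S ω₀ _⋄_ ⋄-at-ω₀ = _\\_ , _//_ , ε , isMoufangLoop
  where
  L : JordanBolLoop (Fin m)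
  L = SchemeLoop.jordanBolLoop F ch S ω₀ _⋄_ ⋄-at-ω₀
  open JordanBolLoop L using (ε)
  open JordanBolLoopProperties L using (_\\_; _//_; isMoufangLoop)
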